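{- Let $\mathbf{m}$ be the Thue–Morse word. If $k\ge2$ and $n>2^{k-1}$, then $\operatorname{nsc}_{\mathbf{m}}(n)\ge 3\cdot 2^{k-1}$.
   Context: The Thue–Morse word is $\mathbf{m}=\mu^{\omega}(0)$, the fixed point starting with $0$ of the morphism $\mu(0)=01$, $\mu(1)=10$. For an infinite word $\mathbf{x}=x_0x_1x_2\cdots$ (indexed from $0$) and $n\ge1$, $\operatorname{nsc}_{\mathbf{x}}(n)=\max\{m\in\mathbb{N}: x_i\cdots x_{i+n-1}\neq x_j\cdots x_{j+n-1}\text{ for all } 0\le i<j\le m-1\}$. -}

module Defs where

open import Data.Nat using (ℕ; zero; suc; _+_; _*_; _^_; _<_)
open import Data.Bool using (Bool; true; false; not)
open import Data.List using (List; []; _∷_; _++_; concatMap; length)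
open import Data.Fin using (Fin)
open import Relation.Binary.PropositionalEquality using (_≡_)
open import Relation.Nullary using (¬_)

Word : Set → Set
Word A = ℕ → A

-- Letters 0,1 are represented by false,true.
-- The Thue–Morse morphism μ(0)=01, μ(1)=10 on a single letter and on finite words.
μ₁ : Bool → List Bool
μ₁ b = b ∷ not b ∷ []

μ : List Bool → List Bool
μ = concatMap μ₁

μ^ : ℕ → List Bool
μ^ zero    = false ∷ []
μ^ (suc k) = μ (μ^ k)

-- Safe lookup with a default (never used out of range below: |μ^(i+1)(0)| = 2^(i+1) > i).
nth : List Bool → ℕ → Bool
nth []       _       = false
nth (b ∷ bs) zero    = b
nth (b ∷ bs) (suc i) = nth bs i

-- The Thue–Morse word m = μ^ω(0): its i-th letter is the i-th letter of the
-- prefix μ^(i+1)(0) (each μ^k(0) is a prefix of μ^(k+1)(0)).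
thueMorse : Word Bool
thueMorse i = nth (μ^ (suc i)) i

SameFactor : {A : Set} → Word A → ℕ → ℕ → ℕ → Set
SameFactor x n i j = ∀ (t : ℕ) → t < n → x (i + t) ≡ x (j + t)

-- The factors of length n starting at positions 0,…,m-1 are pairwise distinct,
-- i.e. m belongs to the set whose maximum is nsc_x(n).
DistinctPrefixFactors : {A : Set} → Word A → ℕ → ℕ → Set
DistinctPrefixFactors x n m = ∀ (i j : ℕ) → i < j → j < m → ¬ SameFactor x n i j

module Submission where

-- Write tm for the Thue–Morse word.  Since each μ^k(0) is
-- a prefix of μ^(k+1)(0), the letters of tm obey
--   tm (2q) = tm q   and   tm (2q+1) = not (tm q).
-- Two facts follow: tm has no three equal consecutive letters, and a factor
-- of length 5 cannot occur both at an even and at an odd position.  Hence two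
-- equal factors of length 2n+1 (n ≥ 2) start at positions of the same parity,
-- and "halving" them gives equal factors of length n+1 at half the positions.
-- This yields the doubling step: if the factors of length n+1 starting before
-- m are pairwise distinct, so are the factors of length 2n+1 starting before
-- 2m.  From a finite check (length 3, positions < 6) and iteration, the
-- factors of length 2^(k-1)+1 starting before 3·2^(k-1) are distinct; longer
-- factors are then distinct a fortiori, which is the theorem.

open import Defs
open import Data.Nat using (ℕ; zero; suc; _+_; _*_; _^_; _∸_; _≤_; _<_; z≤n; s≤s)
open import Data.Nat.Properties
open import Data.Bool using (Bool; not)
open import Data.Bool.Properties using (not-injective; not-involutive; not-¬) renaming (_≟_ to _≟ᵇ_)
open import Data.List using ([]; _∷_; _++_; length; map; concat)
open import Data.List.Properties using (map-++; concat-++; ++-assoc; ++-identityʳ)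
open import Data.Product using (∃; _,_)
open import Data.Unit using (tt)
open import Data.Empty using (⊥)
open import Algebra.Properties.CommutativeSemigroup +-commutativeSemigroup using (interchange)
open import Relation.Binary.Definitions using (DecidableEquality)
open import Relation.Binary.PropositionalEquality
open import Relation.Nullary using (¬_; Dec; yes; no; ¬?; contradiction)
open import Relation.Nullary.Decidable using (map′; toWitness)

open ≡-Reasoning

data Parity : ℕ → Set where
  even : ∀ q → Parity (q + q)
  odd  : ∀ q → Parity (suc (q + q))

double-suc : ∀ q → suc q + suc q ≡ suc (suc (q + q))
double-suc q = cong suc (+-suc q q)

parity : ∀ n → Parity n
parity zero = even 0
parity (suc n) with parity n
... | even q = odd q
... | odd q  = subst Parity (double-suc q) (even (suc q))

double-< : ∀ {x m} → x < m → suc (x + x) < m + m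
double-< {x} {m} x<m = subst (_≤ m + m) (double-suc x) (+-mono-≤ x<m x<m)

half-< : ∀ {x y} → x + x < y + y → x < y
half-< {x} {y} x+x<y+y with x <? y
... | yes x<y = x<y
... | no x≮y  = contradiction (+-mono-≤ (≮⇒≥ x≮y) (≮⇒≥ x≮y)) (<⇒≱ x+x<y+y)

pow2-suc : ∀ k → 2 ^ suc k ≡ 2 ^ k + 2 ^ k
pow2-suc k = cong (2 ^ k +_) (+-identityʳ (2 ^ k))

-- Position i of tm is read off μ^(i+1)(0), whose length 2^(i+1) exceeds i.
n<2^n : ∀ n → n < 2 ^ n
n<2^n zero    = s≤s z≤n
n<2^n (suc n) = subst (suc n <_) (sym (pow2-suc n))
                  (≤-trans (s≤s (s≤s (m≤m+n n n))) (double-< (n<2^n n)))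

n<2^1+n : ∀ n → n < 2 ^ suc n
n<2^1+n n = <-≤-trans (n<2^n n) (^-monoʳ-≤ 2 (n≤1+n n))

μ-++ : ∀ l r → μ (l ++ r) ≡ μ l ++ μ r
μ-++ l r = trans (cong concat (map-++ μ₁ l r)) (sym (concat-++ (map μ₁ l) (map μ₁ r)))

length-μ : ∀ l → length (μ l) ≡ length l + length l
length-μ []      = refl
length-μ (b ∷ l) = begin
  suc (suc (length (μ l)))         ≡⟨ cong (λ z → suc (suc z)) (length-μ l) ⟩
  suc (suc (length l + length l))  ≡⟨ sym (double-suc (length l)) ⟩
  suc (length l) + suc (length l)  ∎

length-μ^ : ∀ k → length (μ^ k) ≡ 2 ^ k
length-μ^ zero    = refl
length-μ^ (suc k) = begin
  length (μ (μ^ k))                 ≡⟨ length-μ (μ^ k) ⟩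
  length (μ^ k) + length (μ^ k)     ≡⟨ cong₂ _+_ (length-μ^ k) (length-μ^ k) ⟩
  2 ^ k + 2 ^ k                     ≡⟨ sym (pow2-suc k) ⟩
  2 ^ suc k                         ∎

nth-μ-even : ∀ l q → nth (μ l) (q + q) ≡ nth l q
nth-μ-even []      q       = refl
nth-μ-even (b ∷ l) zero    = refl
nth-μ-even (b ∷ l) (suc q) rewrite +-suc q q = nth-μ-even l q

nth-μ-odd : ∀ l q → q < length l → nth (μ l) (suc (q + q)) ≡ not (nth l q)
nth-μ-odd (b ∷ l) zero    _         = refl
nth-μ-odd (b ∷ l) (suc q) (s≤s q<l) rewrite +-suc q q = nth-μ-odd l q q<l

nth-++ : ∀ l r {i} → i < length l → nth (l ++ r) i ≡ nth l i
nth-++ (b ∷ l) r {zero}  _         = refl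
nth-++ (b ∷ l) r {suc i} (s≤s i<l) = nth-++ l r i<l

μ^-step : ∀ k → ∃ λ r → μ^ (suc k) ≡ μ^ k ++ r
μ^-step zero    = _ , refl
μ^-step (suc k) with μ^-step k
... | r , eq = μ r , trans (cong μ eq) (μ-++ (μ^ k) r)

μ^-prefix : ∀ d k → ∃ λ r → μ^ (d + k) ≡ μ^ k ++ r
μ^-prefix zero    k = [] , sym (++-identityʳ (μ^ k))
μ^-prefix (suc d) k with μ^-prefix d k | μ^-step (d + k)
... | r , eq | s , eq′ = r ++ s , (begin
  μ^ (suc (d + k))      ≡⟨ eq′ ⟩
  μ^ (d + k) ++ s       ≡⟨ cong (_++ s) eq ⟩
  (μ^ k ++ r) ++ s      ≡⟨ ++-assoc (μ^ k) r s ⟩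
  μ^ k ++ (r ++ s)      ∎)

nth-μ^-stable : ∀ d k i → i < 2 ^ k → nth (μ^ (d + k)) i ≡ nth (μ^ k) i
nth-μ^-stable d k i i<2^k with μ^-prefix d k
... | r , eq = trans (cong (λ w → nth w i) eq)
                     (nth-++ (μ^ k) r (subst (i <_) (sym (length-μ^ k)) i<2^k))

module _ {A : Set} (x : Word A) where

  sameFactor-head : ∀ {n} i j → SameFactor x (suc n) i j → x i ≡ x j
  sameFactor-head i j h =
    subst₂ (λ p q → x p ≡ x q) (+-identityʳ i) (+-identityʳ j) (h 0 (s≤s z≤n))

  sameFactor-tail : ∀ {n} i j → SameFactor x (suc n) i j → SameFactor x n (suc i) (suc j)
  sameFactor-tail i j h t t<n =
    subst₂ (λ p q → x p ≡ x q) (+-suc i t) (+-suc j t) (h (suc t) (s≤s t<n))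

  sameFactor-shorten : ∀ {n n′} i j → n′ ≤ n → SameFactor x n i j → SameFactor x n′ i j
  sameFactor-shorten i j n′≤n h t t<n′ = h t (<-≤-trans t<n′ n′≤n)

  sameFactor-sym : ∀ {n} i j → SameFactor x n i j → SameFactor x n j i
  sameFactor-sym i j h t t<n = sym (h t t<n)

  distinct-lengthen : ∀ {n n′ m} → n′ ≤ n →
    DistinctPrefixFactors x n′ m → DistinctPrefixFactors x n m
  distinct-lengthen n′≤n d i j i<j j<m h = d i j i<j j<m (sameFactor-shorten i j n′≤n h)

  -- Over an alphabet with decidable equality both notions are decidable,
  -- which settles finitely many small cases by computation.
  module _ (_≟_ : DecidableEquality A) where

    sameFactor? : ∀ n i j → Dec (SameFactor x n i j)
    sameFactor? n i j = map′ (λ h t t<n → h {t} t<n) (λ h {t} t<n → h t t<n)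
      (allUpTo? (λ t → x (i + t) ≟ x (j + t)) n)

    distinct? : ∀ n m → Dec (DistinctPrefixFactors x n m)
    distinct? n m = map′ (λ d i j i<j j<m → d {j} j<m {i} i<j)
                         (λ d {j} j<m {i} i<j → d i j i<j j<m)
      (allUpTo? (λ j → allUpTo? (λ i → ¬? (sameFactor? n i j)) j) m)

tm : Word Bool
tm = thueMorse

tm-prefix : ∀ k i → i < 2 ^ k → tm i ≡ nth (μ^ k) i
tm-prefix k i i<2^k = begin
  nth (μ^ (suc i)) i         ≡⟨ sym (nth-μ^-stable k (suc i) i (n<2^1+n i)) ⟩
  nth (μ^ (k + suc i)) i     ≡⟨ cong (λ e → nth (μ^ e) i) (+-comm k (suc i)) ⟩
  nth (μ^ (suc i + k)) i     ≡⟨ nth-μ^-stable (suc i) k i i<2^k ⟩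
  nth (μ^ k) i               ∎

tm-even : ∀ q → tm (q + q) ≡ tm q
tm-even q = trans (tm-prefix (suc (suc q)) (q + q) q+q<)
                  (nth-μ-even (μ^ (suc q)) q)
  where
  q+q< : q + q < 2 ^ suc (suc q)
  q+q< = subst (q + q <_) (sym (pow2-suc (suc q)))
               (<-trans (n<1+n _) (double-< (n<2^1+n q)))

tm-odd : ∀ q → tm (suc (q + q)) ≡ not (tm q)
tm-odd q = trans (tm-prefix (suc (suc q)) (suc (q + q)) 2q+1<)
                 (nth-μ-odd (μ^ (suc q)) q q<len)
  where
  2q+1< : suc (q + q) < 2 ^ suc (suc q)
  2q+1< = subst (suc (q + q) <_) (sym (pow2-suc (suc q))) (double-< (n<2^1+n q))
  q<len : q < length (μ^ (suc q))
  q<len = subst (q <_) (sym (length-μ^ (suc q))) (n<2^1+n q)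

tm-block : ∀ q → tm (suc (q + q)) ≡ not (tm (q + q))
tm-block q = trans (tm-odd q) (cong not (sym (tm-even q)))

tm-block-suc : ∀ q → tm (suc (suc (suc (q + q)))) ≡ not (tm (suc (suc (q + q))))
tm-block-suc q = subst (λ p → tm (suc p) ≡ not (tm p)) (double-suc q) (tm-block (suc q))

tm-no-three-equal : ∀ x → tm x ≡ tm (suc x) → tm (suc x) ≡ tm (suc (suc x)) → ⊥
tm-no-three-equal x e₁ e₂ with parity x
... | even z = not-¬ refl (trans e₁ (tm-block z))
... | odd z  = not-¬ refl (trans e₂ (tm-block-suc z))

tm-even-offset : ∀ x t → tm (x + x + (t + t)) ≡ tm (x + t)
tm-even-offset x t = trans (cong tm (sym (interchange x t x t))) (tm-even (x + t))

tm-odd-offset : ∀ x t → tm (suc (x + x) + (t + t)) ≡ not (tm (x + t))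
tm-odd-offset x t = trans (cong (λ p → tm (suc p)) (sym (interchange x t x t))) (tm-odd (x + t))

-- A factor of length 3 at an even position 2x that recurs at an odd position
-- forces tm(x+1) = tm x: its letters at offsets 0,1 and those at offsets
-- 1,2 each lie in one block of one occurrence, so the letters alternate.
even-odd-repeat : ∀ x y → SameFactor tm 3 (x + x) (suc (y + y)) → tm (suc x) ≡ tm x
even-odd-repeat x y h = begin
  tm (suc x)                        ≡⟨ sym (tm-even (suc x)) ⟩
  tm (suc x + suc x)                ≡⟨ cong tm (double-suc x) ⟩
  tm (suc (suc (x + x)))            ≡⟨ letter₂ ⟩
  tm (suc (suc (suc (y + y))))      ≡⟨ tm-block-suc y ⟩
  not (tm (suc (suc (y + y))))      ≡⟨ cong not (sym letter₁) ⟩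
  not (tm (suc (x + x)))            ≡⟨ cong not (tm-block x) ⟩
  not (not (tm (x + x)))            ≡⟨ not-involutive _ ⟩
  tm (x + x)                        ≡⟨ tm-even x ⟩
  tm x                              ∎
  where
  h₁ : SameFactor tm 2 (suc (x + x)) (suc (suc (y + y)))
  h₁ = sameFactor-tail tm (x + x) (suc (y + y)) h
  h₂ : SameFactor tm 1 (suc (suc (x + x))) (suc (suc (suc (y + y))))
  h₂ = sameFactor-tail tm (suc (x + x)) (suc (suc (y + y))) h₁
  letter₁ : tm (suc (x + x)) ≡ tm (suc (suc (y + y)))
  letter₁ = sameFactor-head tm (suc (x + x)) (suc (suc (y + y))) h₁
  letter₂ : tm (suc (suc (x + x))) ≡ tm (suc (suc (suc (y + y))))
  letter₂ = sameFactor-head tm (suc (suc (x + x))) (suc (suc (suc (y + y)))) h₂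

even-odd-distinct : ∀ x y → ¬ SameFactor tm 5 (x + x) (suc (y + y))
even-odd-distinct x y h = tm-no-three-equal x (sym e₁) (sym e₂)
  where
  e₁ : tm (suc x) ≡ tm x
  e₁ = even-odd-repeat x y
         (sameFactor-shorten tm (x + x) (suc (y + y)) (s≤s (s≤s (s≤s z≤n))) h)
  shifted : SameFactor tm 3 (suc x + suc x) (suc (suc y + suc y))
  shifted = subst₂ (SameFactor tm 3) (sym (double-suc x)) (sym (cong suc (double-suc y)))
                   (sameFactor-tail tm (suc (x + x)) (suc (suc (y + y)))
                     (sameFactor-tail tm (x + x) (suc (y + y)) h))
  e₂ : tm (suc (suc x)) ≡ tm (suc x)
  e₂ = even-odd-repeat (suc x) (suc y) shifted

double-offset : ∀ {n t} → t < suc n → t + t < suc (n + n)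
double-offset (s≤s t≤n) = s≤s (+-mono-≤ t≤n t≤n)

halve-even : ∀ {n} x y → SameFactor tm (suc (n + n)) (x + x) (y + y) →
  SameFactor tm (suc n) x y
halve-even x y h t t<n = begin
  tm (x + t)                ≡⟨ sym (tm-even-offset x t) ⟩
  tm (x + x + (t + t))      ≡⟨ h (t + t) (double-offset t<n) ⟩
  tm (y + y + (t + t))      ≡⟨ tm-even-offset y t ⟩
  tm (y + t)                ∎

halve-odd : ∀ {n} x y → SameFactor tm (suc (n + n)) (suc (x + x)) (suc (y + y)) →
  SameFactor tm (suc n) x y
halve-odd x y h t t<n = not-injective (begin
  not (tm (x + t))               ≡⟨ sym (tm-odd-offset x t) ⟩
  tm (suc (x + x) + (t + t))     ≡⟨ h (t + t) (double-offset t<n) ⟩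
  tm (suc (y + y) + (t + t))     ≡⟨ tm-odd-offset y t ⟩
  not (tm (y + t))               ∎)

5≤1+2n : ∀ {n} → 2 ≤ n → 5 ≤ suc (n + n)
5≤1+2n 2≤n = s≤s (+-mono-≤ 2≤n 2≤n)

distinct-double : ∀ n m → 2 ≤ n → DistinctPrefixFactors tm (suc n) m →
  DistinctPrefixFactors tm (suc (n + n)) (m + m)
distinct-double n m 2≤n d i j i<j j<2m h with parity i | parity j
... | even x | even y = d x y (half-< i<j) (half-< j<2m) (halve-even x y h)
... | odd x  | odd y  =
  d x y (half-< (≤-pred i<j)) (half-< (<-trans (n<1+n _) j<2m)) (halve-odd x y h)
... | even x | odd y  = even-odd-distinct x y (sameFactor-shorten tm i j (5≤1+2n 2≤n) h)
... | odd x  | even y =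
  even-odd-distinct y x (sameFactor-shorten tm j i (5≤1+2n 2≤n) (sameFactor-sym tm i j h))

-- Base case, by computation: 011, 110, 101, 010, 100, 001 are distinct.
distinct-3-6 : DistinctPrefixFactors tm 3 6
distinct-3-6 = toWitness {a? = distinct? tm _≟ᵇ_ 3 6} tt

distinct-pow2 : ∀ a → DistinctPrefixFactors tm (suc (2 ^ suc a)) (3 * 2 ^ suc a)
distinct-pow2 zero    = distinct-3-6
distinct-pow2 (suc a) =
  subst₂ (DistinctPrefixFactors tm) (cong suc (sym (pow2-suc (suc a)))) 3p≡
    (distinct-double p (3 * p) (^-monoʳ-≤ 2 {1} {suc a} (s≤s z≤n)) (distinct-pow2 a))
  where
  p : ℕ
  p = 2 ^ suc a
  3p≡ : 3 * p + 3 * p ≡ 3 * 2 ^ suc (suc a)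
  3p≡ = trans (sym (*-distribˡ-+ 3 p p)) (cong (3 *_) (sym (pow2-suc (suc a))))

mainTheorem8 : (k n : ℕ) → 2 ≤ k → 2 ^ (k ∸ 1) < n →
    DistinctPrefixFactors thueMorse n (3 * 2 ^ (k ∸ 1))
mainTheorem8 (suc (suc a)) n (s≤s (s≤s z≤n)) 2^k<n =
  distinct-lengthen tm 2^k<n (distinct-pow2 a)
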